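{- Let $q\in\mathbb{C}$ with $0<|q|<1$ and $a,b\in\mathbb{C}$. Let $B_{n,k}(a,b)$ ($n\ge k\ge0$) be the unique complex numbers such that for every integer $k\ge0$, $$z^k=\sum_{n=k}^\infty B_{n,k}(a,b)\,z^n\frac{(az;q)_n}{(bz;q)_n}\quad\text{in }\mathbb{C}[[z]].$$ Then for every integer $n\ge1$, as an identity of rational functions of an indeterminate $y$, $$\sum_{k=0}^nB_{n,k}(a,b)y^k=\frac{(b/y;q)_{n-1}}{(a/y;q)_{n}}y^{n}-a\sum_{k=0}^{n-1} B_{n-k,1}(a,b)\,q^{(n-k)k}\, \frac{(b/y;q)_{k}}{(a/y;q)_{k+1}}y^k.$$
   Context: $(x;q)_n=\prod_{i=0}^{n-1}(1-xq^i)$ for $n\ge0$, with $(x;q)_0=1$; quotients $(az;q)_n/(bz;q)_n$ are expanded as formal power series in $z$. -}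

module Defs where

open import Level using (Level)
open import Data.Nat using (ℕ; zero; suc; _∸_; _<ᵇ_) renaming (_+_ to _+ℕ_; _*_ to _*ℕ_)
open import Data.Bool using (if_then_else_)
open import Algebra.Bundles using (CommutativeRing)

-- Formal power series in one indeterminate (call it t) over a commutative
-- ring R, represented by their coefficient sequences.
module PS {c ℓ : Level} (R : CommutativeRing c ℓ) where
  open CommutativeRing R

  Series : Set c
  Series = ℕ → Carrier

  _≈ₛ_ : Series → Series → Set ℓ
  f ≈ₛ g = ∀ m → f m ≈ g m

  pow : Carrier → ℕ → Carrier
  pow x zero    = 1#
  pow x (suc n) = x * pow x n

  sumR : ℕ → (ℕ → Carrier) → Carrier
  sumR zero    f = 0#
  sumR (suc n) f = sumR n f + f n

  const : Carrier → Series
  const x zero    = x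
  const x (suc m) = 0#

  X^ : ℕ → Series
  X^ zero    zero    = 1#
  X^ zero    (suc m) = 0#
  X^ (suc k) zero    = 0#
  X^ (suc k) (suc m) = X^ k m

  _⊕_ : Series → Series → Series
  (f ⊕ g) m = f m + g m

  ⊝_ : Series → Series
  (⊝ f) m = - f m

  _⊖_ : Series → Series → Series
  f ⊖ g = f ⊕ (⊝ g)

  _•_ : Carrier → Series → Series
  (x • f) m = x * f m

  _⊛_ : Series → Series → Series
  (f ⊛ g) m = sumR (suc m) (λ i → f i * g (m ∸ i))

  sumS : ℕ → (ℕ → Series) → Series
  sumS n F m = sumR n (λ i → F i m)

  oneMinus : Carrier → Series
  oneMinus x zero          = 1#
  oneMinus x (suc zero)    = - x
  oneMinus x (suc (suc m)) = 0#

  -- the inverse 1/(1 - x t) = Σ_j x^j t^j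
  geom : Carrier → Series
  geom x j = pow x j

  -- (x t ; q)_n = Π_{i<n} (1 - x q^i t)
  poch : Carrier → Carrier → ℕ → Series
  poch q x zero    = const 1#
  poch q x (suc n) = poch q x n ⊛ oneMinus (x * pow q n)

  -- 1/(x t ; q)_n = Π_{i<n} 1/(1 - x q^i t), as a formal power series
  pochInv : Carrier → Carrier → ℕ → Series
  pochInv q x zero    = const 1#
  pochInv q x (suc n) = pochInv q x n ⊛ geom (x * pow q n)

  quot : Carrier → Carrier → ℕ → Carrier → ℕ → Series
  quot q x m y l = poch q x m ⊛ pochInv q y l

  -- Σ_{n ≥ 0} F n  for a family with F n of order ≥ n (so each coefficient
  -- is a finite sum): coefficient of t^m is Σ_{n ≤ m} (F n)_m
  infSum : (ℕ → Series) → Series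
  infSum F m = sumR (suc m) (λ n → F n m)

  -- The defining expansion of the B_{n,k}(a,b):
  --   t^k = Σ_{n ≥ k} B n k t^n (a t;q)_n / (b t;q)_n   in R[[t]]
  expansionTerm : Carrier → Carrier → Carrier → (ℕ → ℕ → Carrier) → ℕ → ℕ → Series
  expansionTerm q a b B k n =
    if n <ᵇ k then const 0# else (B n k • (X^ n ⊛ quot q a n b n))

  IsBExpansion : Carrier → Carrier → Carrier → (ℕ → ℕ → Carrier) → Set ℓ
  IsBExpansion q a b B = ∀ k → X^ k ≈ₛ infSum (expansionTerm q a b B k)

  -- Left side of the corollary divided by y^n, written in w = 1/y:
  --   y^{-n} Σ_{k=0}^{n} B n k y^k = Σ_{k=0}^{n} B n k w^{n-k}
  corLHS : (ℕ → ℕ → Carrier) → ℕ → Series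
  corLHS B n = sumS (suc n) (λ k → B n k • X^ (n ∸ k))

  -- Right side divided by y^n, written in w = 1/y (so (c/y;q)_k = (c w;q)_k):
  --   (b w;q)_{n-1}/(a w;q)_n
  --     - a Σ_{k=0}^{n-1} B (n-k) 1 q^{(n-k)k} w^{n-k} (b w;q)_k/(a w;q)_{k+1}
  corRHS : Carrier → Carrier → Carrier → (ℕ → ℕ → Carrier) → ℕ → Series
  corRHS q a b B n =
    quot q b (n ∸ 1) a n
    ⊖ (a • sumS n (λ k → (B (n ∸ k) 1 * pow q ((n ∸ k) *ℕ k))
                          • (X^ (n ∸ k) ⊛ quot q b k a (suc k))))

module Submission where

-- Corollary 2.1 is proved as an identity of formal power series over an
-- arbitrary commutative ring R, in four stages.
--  * R[[t]] is a commutative ring, so identities in it can be normalised.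
--  * f_n = t^n (a t;q)_n / (b t;q)_n has order n and leading coefficient 1,
--    hence the coefficients D_n of an expansion Σ_n D_n f_n are unique.
--  * Main computation (GeometricExpansion): expand 1/(1-t) = Σ_k t^k twice.
--    Summing the defining expansions of the t^k gives the coefficients
--    L_n = Σ_k B_{n,k}.  For any d with d_0 = 1, d_{n+1}(1 - a q^n) = d_n(1 - β_n)
--    a telescoping sum gives Σ_n d_n f_n = 1/(1-t) + a Σ_k d_{k+1} q^k t f_k, and
--    q^k t f_k = Σ_j B_{j,1} q^{jk} f_{k+j} (the expansion of t, dilated by q^k)
--    regroups the correction into Σ_n a C_n f_n.  By uniqueness L_n + a C_n = d_n.
--  * The corollary is this identity over R[[w]] (w = 1/y) for the parameters
--    (a w, b w) and d_{n+1} = (b w;q)_n/(a w;q)_{n+1}; the substitution t ↦ w t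
--    turns the hypothesis on B_{n,k} into the one for B_{n,k} w^{n-k}.

open import Level using (Level)
open import Data.Nat using (ℕ; zero; suc; _∸_; _<ᵇ_; _≤_; _<_; s≤s)
  renaming (_+_ to _+ℕ_; _*_ to _*ℕ_)
import Data.Nat.Properties as ℕₚ
open import Data.Bool using (true; false; T; if_then_else_)
open import Data.Empty using (⊥-elim)
open import Data.Sum using (inj₁; inj₂)
open import Data.Product using (_,_)
open import Relation.Nullary using (¬_; yes; no)
import Relation.Binary.PropositionalEquality as ≡
open import Algebra.Bundles using (CommutativeRing)
open import Algebra.Structures using (IsCommutativeRing)
import Algebra.Properties.CommutativeSemigroup as CommSemigroupProperties
import Algebra.Solver.Ring.NaturalCoefficients.Default as NaturalSolver
import Relation.Binary.Reasoning.Setoid as SetoidReasoning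
open import Defs

module RingSolver {c ℓ} (R : CommutativeRing c ℓ) where
  open NaturalSolver (CommutativeRing.commutativeSemiring R) public
    using (solve; con; _:+_; _:*_) renaming (_:=_ to _⊜_)

module FiniteSums {c ℓ} (R : CommutativeRing c ℓ) where
  open CommutativeRing R
  open PS R using (sumR)
  open CommSemigroupProperties +-commutativeSemigroup using (interchange)
  open SetoidReasoning setoid

  sumR-cong : ∀ n {f g : ℕ → Carrier} → (∀ i → i < n → f i ≈ g i) → sumR n f ≈ sumR n g
  sumR-cong zero    h = refl
  sumR-cong (suc n) h = +-cong (sumR-cong n (λ i i<n → h i (ℕₚ.m<n⇒m<1+n i<n))) (h n ℕₚ.≤-refl)

  sumR-cong′ : ∀ n {f g : ℕ → Carrier} → (∀ i → f i ≈ g i) → sumR n f ≈ sumR n g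
  sumR-cong′ n h = sumR-cong n (λ i _ → h i)

  sumR-zero : ∀ n {f : ℕ → Carrier} → (∀ i → i < n → f i ≈ 0#) → sumR n f ≈ 0#
  sumR-zero zero    h = refl
  sumR-zero (suc n) h =
    trans (+-cong (sumR-zero n (λ i i<n → h i (ℕₚ.m<n⇒m<1+n i<n))) (h n ℕₚ.≤-refl)) (+-identityˡ 0#)

  sumR-+ : ∀ n (f g : ℕ → Carrier) → sumR n (λ i → f i + g i) ≈ sumR n f + sumR n g
  sumR-+ zero    f g = sym (+-identityˡ 0#)
  sumR-+ (suc n) f g = trans (+-cong (sumR-+ n f g) refl) (interchange _ _ _ _)

  sumR-*ˡ : ∀ n x (f : ℕ → Carrier) → x * sumR n f ≈ sumR n (λ i → x * f i)
  sumR-*ˡ zero    x f = zeroʳ x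
  sumR-*ˡ (suc n) x f = trans (distribˡ x _ _) (+-cong (sumR-*ˡ n x f) refl)

  sumR-*ʳ : ∀ n x (f : ℕ → Carrier) → sumR n f * x ≈ sumR n (λ i → f i * x)
  sumR-*ʳ n x f = trans (*-comm _ _) (trans (sumR-*ˡ n x f) (sumR-cong′ n (λ i → *-comm x (f i))))

  sumR-head : ∀ n (f : ℕ → Carrier) → sumR (suc n) f ≈ f 0 + sumR n (λ i → f (suc i))
  sumR-head zero    f = trans (+-identityˡ _) (sym (+-identityʳ _))
  sumR-head (suc n) f = trans (+-cong (sumR-head n f) refl) (+-assoc _ _ _)

  sumR-truncate : ∀ {N} M (f : ℕ → Carrier) → N ≤ M → (∀ j → N ≤ j → j < M → f j ≈ 0#) →
                  sumR M f ≈ sumR N f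
  sumR-truncate {N} M f N≤M h with ℕₚ.m≤n⇒m<n∨m≡n N≤M
  ... | inj₂ ≡.refl = refl
  sumR-truncate {N} (suc M) f _ h | inj₁ (s≤s N≤M) =
    trans (+-cong (sumR-truncate M f N≤M (λ j N≤j j<M → h j N≤j (ℕₚ.m<n⇒m<1+n j<M)))
                  (h M N≤M ℕₚ.≤-refl))
          (+-identityʳ _)

  sumR-swap : ∀ n m (F : ℕ → ℕ → Carrier) →
              sumR n (λ i → sumR m (λ j → F i j)) ≈ sumR m (λ j → sumR n (λ i → F i j))
  sumR-swap zero    m F = sym (sumR-zero m (λ _ _ → refl))
  sumR-swap (suc n) m F =
    trans (+-cong (sumR-swap n m F) refl) (sym (sumR-+ m (λ j → sumR n (λ i → F i j)) (λ j → F n j)))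

  sumR-reverse : ∀ m (f : ℕ → Carrier) → sumR (suc m) f ≈ sumR (suc m) (λ i → f (m ∸ i))
  sumR-reverse zero    f = refl
  sumR-reverse (suc m) f = begin
    sumR (suc m) f + f (suc m)                  ≈⟨ +-cong (sumR-reverse m f) refl ⟩
    sumR (suc m) (λ i → f (m ∸ i)) + f (suc m)  ≈⟨ +-comm _ _ ⟩
    f (suc m) + sumR (suc m) (λ i → f (m ∸ i))  ≈⟨ sumR-head (suc m) (λ i → f (suc m ∸ i)) ⟨
    sumR (suc (suc m)) (λ i → f (suc m ∸ i))    ∎

  sumR-triangle : ∀ m (F : ℕ → ℕ → Carrier) →
    sumR (suc m) (λ i → sumR (suc i) (λ j → F j i)) ≈
    sumR (suc m) (λ j → sumR (suc (m ∸ j)) (λ k → F j (j +ℕ k)))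
  sumR-triangle zero    F = refl
  sumR-triangle (suc m) F = begin
    sumR (suc m) (λ i → sumR (suc i) (λ j → F j i)) + sumR (suc (suc m)) (λ j → F j (suc m))
      ≈⟨ +-cong (sumR-triangle m F) refl ⟩
    Σrows + (sumR (suc m) (λ j → F j (suc m)) + F (suc m) (suc m))
      ≈⟨ +-assoc _ _ _ ⟨
    (Σrows + sumR (suc m) (λ j → F j (suc m))) + F (suc m) (suc m)
      ≈⟨ +-cong (sumR-+ (suc m) row (λ j → F j (suc m))) refl ⟨
    sumR (suc m) (λ j → row j + F j (suc m)) + F (suc m) (suc m)
      ≈⟨ +-cong (sumR-cong (suc m) extendRow) lastRow ⟩
    sumR (suc m) (λ j → sumR (suc (suc m ∸ j)) (λ k → F j (j +ℕ k)))
      + sumR (suc (suc m ∸ suc m)) (λ k → F (suc m) (suc m +ℕ k)) ∎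
    where
    row : ℕ → Carrier
    row j = sumR (suc (m ∸ j)) (λ k → F j (j +ℕ k))
    Σrows : Carrier
    Σrows = sumR (suc m) row
    extendRow : ∀ j → j < suc m → row j + F j (suc m) ≈ sumR (suc (suc m ∸ j)) (λ k → F j (j +ℕ k))
    extendRow j (s≤s j≤m) rewrite ℕₚ.+-∸-assoc 1 j≤m =
      +-cong refl (reflexive (≡.cong (F j) (≡.sym (≡.trans (ℕₚ.+-suc j (m ∸ j)) (≡.cong suc (ℕₚ.m+[n∸m]≡n j≤m))))))
    lastRow : F (suc m) (suc m) ≈ sumR (suc (m ∸ m)) (λ k → F (suc m) (suc m +ℕ k))
    lastRow rewrite ℕₚ.n∸n≡0 m | ℕₚ.+-identityʳ m = sym (+-identityˡ _)

  telescope : (T u v : ℕ → Carrier) → (∀ n → T n + v n ≈ u n + T (suc n)) →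
              ∀ N → T 0 + sumR N v ≈ sumR N u + T N
  telescope T u v step zero    = +-comm _ _
  telescope T u v step (suc N) = begin
    T 0 + (sumR N v + v N)    ≈⟨ +-assoc _ _ _ ⟨
    (T 0 + sumR N v) + v N    ≈⟨ +-cong (telescope T u v step N) refl ⟩
    (sumR N u + T N) + v N    ≈⟨ +-assoc _ _ _ ⟩
    sumR N u + (T N + v N)    ≈⟨ +-cong refl (step N) ⟩
    sumR N u + (u N + T (suc N))  ≈⟨ +-assoc _ _ _ ⟨
    (sumR N u + u N) + T (suc N) ∎

module PowerSeriesRing {c ℓ} (R : CommutativeRing c ℓ) where
  open CommutativeRing R
  open PS R
  open FiniteSums R

  ≈ₛ-refl : ∀ {f} → f ≈ₛ f
  ≈ₛ-refl m = refl

  ≈ₛ-sym : ∀ {f g} → f ≈ₛ g → g ≈ₛ f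
  ≈ₛ-sym p m = sym (p m)

  ≈ₛ-trans : ∀ {f g h} → f ≈ₛ g → g ≈ₛ h → f ≈ₛ h
  ≈ₛ-trans p q m = trans (p m) (q m)

  const-zero : ∀ m → const 0# m ≈ 0#
  const-zero zero    = refl
  const-zero (suc m) = refl

  ⊕-cong : ∀ {f f′ g g′} → f ≈ₛ f′ → g ≈ₛ g′ → (f ⊕ g) ≈ₛ (f′ ⊕ g′)
  ⊕-cong p q m = +-cong (p m) (q m)

  ⊝-cong : ∀ {f g} → f ≈ₛ g → (⊝ f) ≈ₛ (⊝ g)
  ⊝-cong p m = -‿cong (p m)

  ⊛-cong : ∀ {f f′ g g′} → f ≈ₛ f′ → g ≈ₛ g′ → (f ⊛ g) ≈ₛ (f′ ⊛ g′)
  ⊛-cong p q m = sumR-cong′ (suc m) (λ i → *-cong (p i) (q (m ∸ i)))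

  ⊛-congˡ : ∀ {f f′} g → f ≈ₛ f′ → (f ⊛ g) ≈ₛ (f′ ⊛ g)
  ⊛-congˡ g p = ⊛-cong p (≈ₛ-refl {g})

  ⊛-congʳ : ∀ f {g g′} → g ≈ₛ g′ → (f ⊛ g) ≈ₛ (f ⊛ g′)
  ⊛-congʳ f p = ⊛-cong (≈ₛ-refl {f}) p

  ⊛-comm : ∀ f g → (f ⊛ g) ≈ₛ (g ⊛ f)
  ⊛-comm f g m = trans (sumR-reverse m (λ i → f i * g (m ∸ i)))
    (sumR-cong (suc m) (λ i i≤m → trans (*-comm _ _)
      (reflexive (≡.cong (λ k → g k * f (m ∸ i)) (ℕₚ.m∸[m∸n]≡n (ℕₚ.≤-pred i≤m))))))

  ⊛-identityˡ : ∀ f → (const 1# ⊛ f) ≈ₛ f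
  ⊛-identityˡ f m = begin
    sumR (suc m) (λ i → const 1# i * f (m ∸ i))   ≈⟨ sumR-head m (λ i → const 1# i * f (m ∸ i)) ⟩
    1# * f m + sumR m (λ i → 0# * f (m ∸ suc i))  ≈⟨ +-cong (*-identityˡ _) (sumR-zero m (λ i _ → zeroˡ _)) ⟩
    f m + 0#                                      ≈⟨ +-identityʳ _ ⟩
    f m                                           ∎
    where open SetoidReasoning setoid

  ⊛-distribˡ : ∀ f g h → (f ⊛ (g ⊕ h)) ≈ₛ ((f ⊛ g) ⊕ (f ⊛ h))
  ⊛-distribˡ f g h m = trans (sumR-cong′ (suc m) (λ i → distribˡ _ _ _))
    (sumR-+ (suc m) (λ i → f i * g (m ∸ i)) (λ i → f i * h (m ∸ i)))

  -- both sides are the sum of f_i g_j h_k over i + j + k = m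
  ⊛-assoc : ∀ f g h → ((f ⊛ g) ⊛ h) ≈ₛ (f ⊛ (g ⊛ h))
  ⊛-assoc f g h m = begin
    sumR (suc m) (λ i → sumR (suc i) (λ j → f j * g (i ∸ j)) * h (m ∸ i))
      ≈⟨ sumR-cong′ (suc m) (λ i → sumR-*ʳ (suc i) (h (m ∸ i)) (λ j → f j * g (i ∸ j))) ⟩
    sumR (suc m) (λ i → sumR (suc i) (λ j → f j * g (i ∸ j) * h (m ∸ i)))
      ≈⟨ sumR-triangle m (λ j i → f j * g (i ∸ j) * h (m ∸ i)) ⟩
    sumR (suc m) (λ j → sumR (suc (m ∸ j)) (λ k → f j * g ((j +ℕ k) ∸ j) * h (m ∸ (j +ℕ k))))
      ≈⟨ sumR-cong′ (suc m) (λ j → trans (sumR-cong′ (suc (m ∸ j)) (reindex j))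
                                          (sym (sumR-*ˡ (suc (m ∸ j)) (f j) (λ k → g k * h ((m ∸ j) ∸ k))))) ⟩
    sumR (suc m) (λ j → f j * sumR (suc (m ∸ j)) (λ k → g k * h ((m ∸ j) ∸ k))) ∎
    where
    open SetoidReasoning setoid
    reindex : ∀ j k → f j * g ((j +ℕ k) ∸ j) * h (m ∸ (j +ℕ k)) ≈ f j * (g k * h ((m ∸ j) ∸ k))
    reindex j k = trans (*-assoc _ _ _)
      (*-cong refl (reflexive (≡.cong₂ (λ x y → g x * h y) (ℕₚ.m+n∸m≡n j k) (≡.sym (ℕₚ.∸-+-assoc m j k)))))

  seriesIsCommutativeRing : IsCommutativeRing _≈ₛ_ _⊕_ _⊛_ ⊝_ (const 0#) (const 1#)
  seriesIsCommutativeRing = record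
    { isRing = record
      { +-isAbelianGroup = record
        { isGroup = record
          { isMonoid = record
            { isSemigroup = record
              { isMagma = record
                { isEquivalence = record { refl = ≈ₛ-refl ; sym = ≈ₛ-sym ; trans = ≈ₛ-trans }
                ; ∙-cong = ⊕-cong }
              ; assoc = λ f g h m → +-assoc (f m) (g m) (h m) }
            ; identity = (λ f m → trans (+-cong (const-zero m) refl) (+-identityˡ (f m)))
                       , (λ f m → trans (+-cong refl (const-zero m)) (+-identityʳ (f m))) }
          ; inverse = (λ f m → trans (-‿inverseˡ (f m)) (sym (const-zero m)))
                    , (λ f m → trans (-‿inverseʳ (f m)) (sym (const-zero m)))
          ; ⁻¹-cong = ⊝-cong }
        ; comm = λ f g m → +-comm (f m) (g m) }
      ; *-cong = ⊛-cong
      ; *-assoc = ⊛-assoc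
      ; *-identity = ⊛-identityˡ , (λ f → ≈ₛ-trans (⊛-comm f (const 1#)) (⊛-identityˡ f))
      ; distrib = ⊛-distribˡ
                , (λ f g h → ≈ₛ-trans (⊛-comm (g ⊕ h) f)
                               (≈ₛ-trans (⊛-distribˡ f g h) (⊕-cong (⊛-comm f g) (⊛-comm f h)))) }
    ; *-comm = ⊛-comm }

  seriesRing : CommutativeRing c ℓ
  seriesRing = record { isCommutativeRing = seriesIsCommutativeRing }

  module SeriesReasoning = SetoidReasoning (CommutativeRing.setoid seriesRing)

  ⊕≈⇒≈⊖ : ∀ {f g h} → (f ⊕ g) ≈ₛ h → f ≈ₛ (h ⊖ g)
  ⊕≈⇒≈⊖ {f} {g} {h} p = begin
    f                  ≈⟨ xyx⁻¹≈y g f ⟨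
    (g ⊕ f) ⊖ g        ≈⟨ ⊕-cong (λ m → +-comm (g m) (f m)) (≈ₛ-refl {⊝ g}) ⟩
    (f ⊕ g) ⊖ g        ≈⟨ ⊕-cong p (≈ₛ-refl {⊝ g}) ⟩
    h ⊖ g              ∎
    where
    open SeriesReasoning
    open import Algebra.Properties.AbelianGroup (CommutativeRing.+-abelianGroup seriesRing) using (xyx⁻¹≈y)

module SeriesToolkit {c ℓ} (R : CommutativeRing c ℓ) where
  open CommutativeRing R
  open PS R
  open FiniteSums R
  open PowerSeriesRing R
  module ScalarReasoning = SetoidReasoning setoid
  module S = RingSolver seriesRing
  open CommSemigroupProperties *-commutativeSemigroup using (interchange; x∙yz≈y∙xz)
  open import Algebra.Properties.Ring ring using (-‿distribˡ-*; -‿distribʳ-*)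

  const⊛≈• : ∀ x f → (const x ⊛ f) ≈ₛ (x • f)
  const⊛≈• x f m = trans (sumR-head m (λ i → const x i * f (m ∸ i)))
    (trans (+-cong refl (sumR-zero m (λ i _ → zeroˡ _))) (+-identityʳ _))

  const-cong : ∀ {x y} → x ≈ y → const x ≈ₛ const y
  const-cong p zero    = p
  const-cong p (suc m) = refl

  const-* : ∀ x y → (const x ⊛ const y) ≈ₛ const (x * y)
  const-* x y = ≈ₛ-trans (const⊛≈• x (const y)) scaled
    where
    scaled : (x • const y) ≈ₛ const (x * y)
    scaled zero    = refl
    scaled (suc m) = zeroʳ x

  const-+ : ∀ x y → (const x ⊕ const y) ≈ₛ const (x + y)
  const-+ x y zero    = refl
  const-+ x y (suc m) = +-identityʳ 0#

  •-cong : ∀ {x y f g} → x ≈ y → f ≈ₛ g → (x • f) ≈ₛ (y • g)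
  •-cong p q m = *-cong p (q m)

  •-assoc : ∀ x y f → (x • (y • f)) ≈ₛ ((x * y) • f)
  •-assoc x y f m = sym (*-assoc x y (f m))

  •-⊛ : ∀ x f g → ((x • f) ⊛ g) ≈ₛ (x • (f ⊛ g))
  •-⊛ x f g = ≈ₛ-trans (⊛-congˡ g (≈ₛ-sym (const⊛≈• x f)))
                (≈ₛ-trans (⊛-assoc (const x) f g) (const⊛≈• x (f ⊛ g)))

  X^-zero : X^ 0 ≈ₛ const 1#
  X^-zero zero    = refl
  X^-zero (suc m) = refl

  X^-head : ∀ k f → (X^ (suc k) ⊛ f) 0 ≈ 0#
  X^-head k f = trans (+-identityˡ _) (zeroˡ _)

  X^-shift : ∀ k f m → (X^ (suc k) ⊛ f) (suc m) ≈ (X^ k ⊛ f) m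
  X^-shift k f m = trans (sumR-head (suc m) (λ i → X^ (suc k) i * f (suc m ∸ i)))
    (trans (+-cong (zeroˡ _) refl) (+-identityˡ _))

  X^-at : ∀ k f l → (X^ k ⊛ f) (k +ℕ l) ≈ f l
  X^-at zero    f l = trans (⊛-congˡ f X^-zero l) (⊛-identityˡ f l)
  X^-at (suc k) f l = trans (X^-shift k f (k +ℕ l)) (X^-at k f l)

  X^-+ : ∀ k j → X^ (k +ℕ j) ≈ₛ (X^ k ⊛ X^ j)
  X^-+ zero    j = ≈ₛ-sym (≈ₛ-trans (⊛-congˡ (X^ j) X^-zero) (⊛-identityˡ (X^ j)))
  X^-+ (suc k) j zero    = sym (X^-head k (X^ j))
  X^-+ (suc k) j (suc m) = trans (X^-+ k j m) (sym (X^-shift k (X^ j) m))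

  X^-cancel : ∀ k {u v} → (X^ k ⊛ u) ≈ₛ (X^ k ⊛ v) → u ≈ₛ v
  X^-cancel k {u} {v} p i = trans (sym (X^-at k u i)) (trans (p (k +ℕ i)) (X^-at k v i))

  Ord : ℕ → Series → Set ℓ
  Ord n f = ∀ l → l < n → f l ≈ 0#

  X^-ord : ∀ k f → Ord k (X^ k ⊛ f)
  X^-ord (suc k) f zero    _         = X^-head k f
  X^-ord (suc k) f (suc l) (s≤s l<k) = trans (X^-shift k f l) (X^-ord k f l l<k)

  ord-⊛ : ∀ n f g → Ord n f → Ord n (f ⊛ g)
  ord-⊛ n f g o l l<n =
    sumR-zero (suc l) (λ i i≤l → trans (*-cong (o i (ℕₚ.<-≤-trans i≤l l<n)) refl) (zeroˡ _))

  ord-• : ∀ n x f → Ord n f → Ord n (x • f)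
  ord-• n x f o l l<n = trans (*-cong refl (o l l<n)) (zeroʳ x)

  pow-cong : ∀ {x y} n → x ≈ y → pow x n ≈ pow y n
  pow-cong zero    p = refl
  pow-cong (suc n) p = *-cong p (pow-cong n p)

  pow-+ : ∀ x i j → pow x (i +ℕ j) ≈ pow x i * pow x j
  pow-+ x zero    j = sym (*-identityˡ _)
  pow-+ x (suc i) j = trans (*-cong refl (pow-+ x i j)) (sym (*-assoc _ _ _))

  pow-* : ∀ x y n → pow (x * y) n ≈ pow x n * pow y n
  pow-* x y zero    = sym (*-identityˡ _)
  pow-* x y (suc n) = trans (*-cong refl (pow-* x y n)) (interchange x y _ _)

  pow-pow : ∀ x i j → pow (pow x i) j ≈ pow x (j *ℕ i)
  pow-pow x i zero    = refl
  pow-pow x i (suc j) = trans (*-cong refl (pow-pow x i j)) (sym (pow-+ x i (j *ℕ i)))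

  pow-1# : ∀ n → pow 1# n ≈ 1#
  pow-1# zero    = refl
  pow-1# (suc n) = trans (*-identityˡ _) (pow-1# n)

  oneMinus-cong : ∀ {x y} → x ≈ y → oneMinus x ≈ₛ oneMinus y
  oneMinus-cong p zero          = refl
  oneMinus-cong p (suc zero)    = -‿cong p
  oneMinus-cong p (suc (suc m)) = refl

  geom-cong : ∀ {x y} → x ≈ y → geom x ≈ₛ geom y
  geom-cong p m = pow-cong m p

  geom-inverse : ∀ x → (geom x ⊛ oneMinus x) ≈ₛ const 1#
  geom-inverse x = ≈ₛ-trans (⊛-comm (geom x) (oneMinus x)) coefficients
    where
    coefficients : (oneMinus x ⊛ geom x) ≈ₛ const 1#
    coefficients zero    = trans (+-identityˡ _) (*-identityˡ _)
    coefficients (suc m) = begin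
      sumR (suc (suc m)) (λ i → oneMinus x i * pow x (suc m ∸ i))
        ≈⟨ sumR-head (suc m) (λ i → oneMinus x i * pow x (suc m ∸ i)) ⟩
      1# * pow x (suc m) + sumR (suc m) (λ i → oneMinus x (suc i) * pow x (m ∸ i))
        ≈⟨ +-cong refl (sumR-head m (λ i → oneMinus x (suc i) * pow x (m ∸ i))) ⟩
      1# * pow x (suc m) + ((- x) * pow x m + sumR m (λ i → 0# * pow x (m ∸ suc i)))
        ≈⟨ +-cong (*-identityˡ _) (+-cong (sym (-‿distribˡ-* x (pow x m))) (sumR-zero m (λ i _ → zeroˡ _))) ⟩
      x * pow x m + (- (x * pow x m) + 0#)
        ≈⟨ +-cong refl (+-identityʳ _) ⟩
      x * pow x m + (- (x * pow x m))
        ≈⟨ -‿inverseʳ _ ⟩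
      0# ∎
      where open ScalarReasoning

  X : Series
  X = X^ 1

  G : Series
  G = geom 1#

  G-rec : G ≈ₛ (const 1# ⊕ (X ⊛ G))
  G-rec zero    = sym (trans (+-cong refl (X^-head 0 G)) (+-identityʳ 1#))
  G-rec (suc m) = begin
    1# * pow 1# m          ≈⟨ *-identityˡ _ ⟩
    pow 1# m               ≈⟨ ⊛-identityˡ G m ⟨
    (const 1# ⊛ G) m       ≈⟨ ⊛-congˡ G X^-zero m ⟨
    (X^ 0 ⊛ G) m           ≈⟨ X^-shift 0 G m ⟨
    (X ⊛ G) (suc m)        ≈⟨ +-identityˡ _ ⟨
    0# + (X ⊛ G) (suc m)   ∎
    where open ScalarReasoning

  oneMinus-split : ∀ x → oneMinus x ≈ₛ (oneMinus 1# ⊕ (const (1# - x) ⊛ X))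
  oneMinus-split x m = sym (trans (+-cong refl (const⊛≈• (1# - x) X m)) (coefficient m))
    where
    coefficient : ∀ m → oneMinus 1# m + (1# - x) * X m ≈ oneMinus x m
    coefficient zero          = trans (+-cong refl (zeroʳ _)) (+-identityʳ _)
    coefficient (suc zero)    = begin
      - 1# + (1# - x) * 1#  ≈⟨ +-cong refl (*-identityʳ _) ⟩
      - 1# + (1# + - x)     ≈⟨ +-assoc _ _ _ ⟨
      (- 1# + 1#) + - x     ≈⟨ +-cong (-‿inverseˡ 1#) refl ⟩
      0# + - x              ≈⟨ +-identityˡ _ ⟩
      - x                   ∎
      where open ScalarReasoning
    coefficient (suc (suc m)) = trans (+-cong refl (zeroʳ _)) (+-identityʳ _)

  oneMinus-G : ∀ x → (oneMinus x ⊛ G) ≈ₛ (const 1# ⊕ (const (1# - x) ⊛ (X ⊛ G)))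
  oneMinus-G x = begin
    oneMinus x ⊛ G                                   ≈⟨ ⊛-congˡ G (oneMinus-split x) ⟩
    (oneMinus 1# ⊕ (const (1# - x) ⊛ X)) ⊛ G
      ≈⟨ S.solve 4 (λ g y k t → ((y S.:+ (k S.:* t)) S.:* g) S.⊜ ((g S.:* y) S.:+ (k S.:* (t S.:* g))))
                   ≈ₛ-refl G (oneMinus 1#) (const (1# - x)) X ⟩
    (G ⊛ oneMinus 1#) ⊕ (const (1# - x) ⊛ (X ⊛ G))  ≈⟨ ⊕-cong (geom-inverse 1#) ≈ₛ-refl ⟩
    const 1# ⊕ (const (1# - x) ⊛ (X ⊛ G))           ∎
    where open SeriesReasoning

  G-as-sum : infSum X^ ≈ₛ G
  G-as-sum m = trans (+-cong (sumR-zero m (λ k k<m → off k<m)) (diag m)) (trans (+-identityˡ 1#) (sym (pow-1# m)))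
    where
    off : ∀ {k m} → k < m → X^ k m ≈ 0#
    off {zero}  {suc m} _         = refl
    off {suc k} {suc m} (s≤s k<m) = off k<m
    diag : ∀ m → X^ m m ≈ 1#
    diag zero    = refl
    diag (suc m) = diag m

  σ : Carrier → Series → Series
  σ c f i = pow c i * f i

  σ-cong : ∀ c {f g} → f ≈ₛ g → σ c f ≈ₛ σ c g
  σ-cong c p i = *-cong refl (p i)

  σ-⊛ : ∀ c f g → σ c (f ⊛ g) ≈ₛ (σ c f ⊛ σ c g)
  σ-⊛ c f g m = trans (sumR-*ˡ (suc m) (pow c m) (λ i → f i * g (m ∸ i)))
    (sumR-cong (suc m) (λ i i≤m → begin
      pow c m * (f i * g (m ∸ i))
        ≈⟨ *-cong (trans (reflexive (≡.cong (pow c) (≡.sym (ℕₚ.m+[n∸m]≡n (ℕₚ.≤-pred i≤m))))) (pow-+ c i (m ∸ i))) refl ⟩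
      (pow c i * pow c (m ∸ i)) * (f i * g (m ∸ i))  ≈⟨ interchange _ _ _ _ ⟩
      (pow c i * f i) * (pow c (m ∸ i) * g (m ∸ i))  ∎))
    where open ScalarReasoning

  σ-• : ∀ c x f → σ c (x • f) ≈ₛ (x • σ c f)
  σ-• c x f m = x∙yz≈y∙xz (pow c m) x (f m)

  σ-X^ : ∀ c n → σ c (X^ n) ≈ₛ (pow c n • X^ n)
  σ-X^ c zero    zero    = refl
  σ-X^ c zero    (suc m) = trans (zeroʳ _) (sym (zeroʳ _))
  σ-X^ c (suc n) zero    = trans (zeroʳ _) (sym (zeroʳ _))
  σ-X^ c (suc n) (suc m) = trans (*-assoc _ _ _) (trans (*-cong refl (σ-X^ c n m)) (sym (*-assoc _ _ _)))

  σ-const1 : ∀ c → σ c (const 1#) ≈ₛ const 1#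
  σ-const1 c zero    = *-identityˡ _
  σ-const1 c (suc m) = zeroʳ _

  σ-oneMinus : ∀ c x → σ c (oneMinus x) ≈ₛ oneMinus (x * c)
  σ-oneMinus c x zero          = *-identityˡ _
  σ-oneMinus c x (suc zero)    =
    trans (*-cong (*-identityʳ c) refl) (trans (sym (-‿distribʳ-* c x)) (-‿cong (*-comm c x)))
  σ-oneMinus c x (suc (suc m)) = zeroʳ _

  σ-geom : ∀ c x → σ c (geom x) ≈ₛ geom (x * c)
  σ-geom c x m = trans (*-comm _ _) (sym (pow-* x c m))

  σ-ord : ∀ n c f → Ord n f → Ord n (σ c f)
  σ-ord n c f o l l<n = trans (*-cong refl (o l l<n)) (zeroʳ _)

  infSum-cong : ∀ {F F′ : ℕ → Series} → (∀ n → F n ≈ₛ F′ n) → infSum F ≈ₛ infSum F′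
  infSum-cong p m = sumR-cong′ (suc m) (λ n → p n m)

  •-infSum : ∀ x F → (x • infSum F) ≈ₛ infSum (λ n → x • F n)
  •-infSum x F m = sumR-*ˡ (suc m) x (λ n → F n m)

  σ-infSum : ∀ c F → σ c (infSum F) ≈ₛ infSum (λ n → σ c (F n))
  σ-infSum c F m = sumR-*ˡ (suc m) (pow c m) (λ n → F n m)

  ⊛-infSum : ∀ g (H : ℕ → Series) → (∀ j → Ord j (H j)) →
             (g ⊛ infSum H) ≈ₛ infSum (λ j → g ⊛ H j)
  ⊛-infSum g H ord m = begin
    sumR (suc m) (λ i → g i * sumR (suc (m ∸ i)) (λ j → H j (m ∸ i)))
      ≈⟨ sumR-cong (suc m) (λ i i≤m → trans (sumR-*ˡ (suc (m ∸ i)) (g i) (λ j → H j (m ∸ i)))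
                                            (sym (extend i (ℕₚ.≤-pred i≤m)))) ⟩
    sumR (suc m) (λ i → sumR (suc m) (λ j → g i * H j (m ∸ i)))
      ≈⟨ sumR-swap (suc m) (suc m) (λ i j → g i * H j (m ∸ i)) ⟩
    sumR (suc m) (λ j → sumR (suc m) (λ i → g i * H j (m ∸ i))) ∎
    where
    open ScalarReasoning
    -- the j-th summand vanishes in degree m - i once j exceeds m - i
    extend : ∀ i → i ≤ m → sumR (suc m) (λ j → g i * H j (m ∸ i)) ≈ sumR (suc (m ∸ i)) (λ j → g i * H j (m ∸ i))
    extend i i≤m = sumR-truncate (suc m) (λ j → g i * H j (m ∸ i)) (s≤s (ℕₚ.m∸n≤m m i))
      (λ j m∸i<j _ → trans (*-cong refl (ord j (m ∸ i) m∸i<j)) (zeroʳ _))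

module Pochhammer {c ℓ} (R : CommutativeRing c ℓ) (q : CommutativeRing.Carrier R) where
  open CommutativeRing R
  open PS R
  open PowerSeriesRing R
  open SeriesToolkit R
  open CommSemigroupProperties *-commutativeSemigroup using (xy∙z≈xz∙y)

  poch-cong : ∀ {x y} n → x ≈ y → poch q x n ≈ₛ poch q y n
  poch-cong zero    p = ≈ₛ-refl
  poch-cong (suc n) p = ⊛-cong (poch-cong n p) (oneMinus-cong (*-cong p refl))

  pochInv-cong : ∀ {x y} n → x ≈ y → pochInv q x n ≈ₛ pochInv q y n
  pochInv-cong zero    p = ≈ₛ-refl
  pochInv-cong (suc n) p = ⊛-cong (pochInv-cong n p) (geom-cong (*-cong p refl))

  σ-poch : ∀ c x n → σ c (poch q x n) ≈ₛ poch q (x * c) n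
  σ-poch c x zero    = σ-const1 c
  σ-poch c x (suc n) = ≈ₛ-trans (σ-⊛ c (poch q x n) (oneMinus (x * pow q n)))
    (⊛-cong (σ-poch c x n) (≈ₛ-trans (σ-oneMinus c _) (oneMinus-cong (xy∙z≈xz∙y x (pow q n) c))))

  σ-pochInv : ∀ c x n → σ c (pochInv q x n) ≈ₛ pochInv q (x * c) n
  σ-pochInv c x zero    = σ-const1 c
  σ-pochInv c x (suc n) = ≈ₛ-trans (σ-⊛ c (pochInv q x n) (geom (x * pow q n)))
    (⊛-cong (σ-pochInv c x n) (≈ₛ-trans (σ-geom c _) (geom-cong (xy∙z≈xz∙y x (pow q n) c))))

  poch-+ : ∀ x k j → (poch q x k ⊛ poch q (x * pow q k) j) ≈ₛ poch q x (k +ℕ j)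
  poch-+ x k zero rewrite ℕₚ.+-identityʳ k =
    ≈ₛ-trans (⊛-comm (poch q x k) (const 1#)) (⊛-identityˡ (poch q x k))
  poch-+ x k (suc j) rewrite ℕₚ.+-suc k j =
    ≈ₛ-trans (≈ₛ-sym (⊛-assoc (poch q x k) (poch q (x * pow q k) j) (oneMinus (x * pow q k * pow q j))))
      (⊛-cong (poch-+ x k j) (oneMinus-cong (trans (*-assoc _ _ _) (*-cong refl (sym (pow-+ q k j))))))

  pochInv-+ : ∀ x k j → (pochInv q x k ⊛ pochInv q (x * pow q k) j) ≈ₛ pochInv q x (k +ℕ j)
  pochInv-+ x k zero rewrite ℕₚ.+-identityʳ k =
    ≈ₛ-trans (⊛-comm (pochInv q x k) (const 1#)) (⊛-identityˡ (pochInv q x k))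
  pochInv-+ x k (suc j) rewrite ℕₚ.+-suc k j =
    ≈ₛ-trans (≈ₛ-sym (⊛-assoc (pochInv q x k) (pochInv q (x * pow q k) j) (geom (x * pow q k * pow q j))))
      (⊛-cong (pochInv-+ x k j) (geom-cong (trans (*-assoc _ _ _) (*-cong refl (sym (pow-+ q k j))))))

  poch-head : ∀ x n → poch q x n 0 ≈ 1#
  poch-head x zero    = refl
  poch-head x (suc n) = trans (+-identityˡ _) (trans (*-identityʳ _) (poch-head x n))

  pochInv-head : ∀ x n → pochInv q x n 0 ≈ 1#
  pochInv-head x zero    = refl
  pochInv-head x (suc n) = trans (+-identityˡ _) (trans (*-identityʳ _) (pochInv-head x n))

  quot-head : ∀ x m y l → quot q x m y l 0 ≈ 1#
  quot-head x m y l = trans (+-identityˡ _) (trans (*-cong (poch-head x m) (pochInv-head y l)) (*-identityˡ _))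

  quot-numerator : ∀ x m y l → (quot q x m y l ⊛ oneMinus (x * pow q m)) ≈ₛ quot q x (suc m) y l
  quot-numerator x m y l =
    S.solve 3 (λ p i o → ((p S.:* i) S.:* o) S.⊜ ((p S.:* o) S.:* i)) ≈ₛ-refl
      (poch q x m) (pochInv q y l) (oneMinus (x * pow q m))

  quot-denominator : ∀ x m y l → (quot q x m y (suc l) ⊛ oneMinus (y * pow q l)) ≈ₛ quot q x m y l
  quot-denominator x m y l = begin
    (P ⊛ (I ⊛ geom β)) ⊛ oneMinus β
      ≈⟨ S.solve 4 (λ p i g o → ((p S.:* (i S.:* g)) S.:* o) S.⊜ ((p S.:* i) S.:* (g S.:* o))) ≈ₛ-refl
                   P I (geom β) (oneMinus β) ⟩
    (P ⊛ I) ⊛ (geom β ⊛ oneMinus β)   ≈⟨ ⊛-congʳ (P ⊛ I) (geom-inverse β) ⟩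
    (P ⊛ I) ⊛ const 1#                 ≈⟨ ⊛-comm (P ⊛ I) (const 1#) ⟩
    const 1# ⊛ (P ⊛ I)                 ≈⟨ ⊛-identityˡ (P ⊛ I) ⟩
    P ⊛ I                              ∎
    where
    open SeriesReasoning
    P I : Series
    P = poch q x m
    I = pochInv q y l
    β : Carrier
    β = y * pow q l

  -- The family  f_n = t^n (a t;q)_n / (b t;q)_n  used as a basis of R[[t]].
  module Basis (a b : Carrier) where
    Q : ℕ → Series
    Q n = quot q a n b n

    f : ℕ → Series
    f n = X^ n ⊛ Q n

    f-ord : ∀ n → Ord n (f n)
    f-ord n = X^-ord n (Q n)

    f-diag : ∀ n → f n n ≈ 1#
    f-diag n = trans (reflexive (≡.cong (f n) (≡.sym (ℕₚ.+-identityʳ n))))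
                     (trans (X^-at n (Q n) 0) (quot-head a n b n))

    f-rec : ∀ n → (oneMinus (b * pow q n) ⊛ f (suc n)) ≈ₛ ((X ⊛ f n) ⊛ oneMinus (a * pow q n))
    f-rec n = begin
      oneMinus β ⊛ (X^ (suc n) ⊛ Q (suc n))     ≈⟨ S.solve 3 (λ o x r → (o S.:* (x S.:* r)) S.⊜ (x S.:* (r S.:* o)))
                                                                 ≈ₛ-refl (oneMinus β) (X^ (suc n)) (Q (suc n)) ⟩
      X^ (suc n) ⊛ (Q (suc n) ⊛ oneMinus β)     ≈⟨ ⊛-cong (X^-+ 1 n) (quot-denominator a (suc n) b n) ⟩
      (X ⊛ X^ n) ⊛ quot q a (suc n) b n         ≈⟨ ⊛-congʳ (X ⊛ X^ n) (≈ₛ-sym (quot-numerator a n b n)) ⟩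
      (X ⊛ X^ n) ⊛ (Q n ⊛ oneMinus α)
        ≈⟨ S.solve 4 (λ x xn r o → ((x S.:* xn) S.:* (r S.:* o)) S.⊜ ((x S.:* (xn S.:* r)) S.:* o))
                     ≈ₛ-refl X (X^ n) (Q n) (oneMinus α) ⟩
      (X ⊛ f n) ⊛ oneMinus α                    ∎
      where
      open SeriesReasoning
      α β : Carrier
      α = a * pow q n
      β = b * pow q n

    σ-f : ∀ k j → σ (pow q k) (f j) ≈ₛ (pow q (j *ℕ k) • (X^ j ⊛ quot q (a * pow q k) j (b * pow q k) j))
    σ-f k j = begin
      σ qᵏ (X^ j ⊛ (poch q a j ⊛ pochInv q b j))
        ≈⟨ ≈ₛ-trans (σ-⊛ qᵏ (X^ j) (Q j)) (⊛-cong (σ-X^ qᵏ j) (σ-⊛ qᵏ (poch q a j) (pochInv q b j))) ⟩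
      (pow qᵏ j • X^ j) ⊛ (σ qᵏ (poch q a j) ⊛ σ qᵏ (pochInv q b j))
        ≈⟨ ⊛-cong (•-cong (pow-pow q k j) ≈ₛ-refl) (⊛-cong (σ-poch qᵏ a j) (σ-pochInv qᵏ b j)) ⟩
      (pow q (j *ℕ k) • X^ j) ⊛ quot q (a * qᵏ) j (b * qᵏ) j
        ≈⟨ •-⊛ (pow q (j *ℕ k)) (X^ j) (quot q (a * qᵏ) j (b * qᵏ) j) ⟩
      pow q (j *ℕ k) • (X^ j ⊛ quot q (a * qᵏ) j (b * qᵏ) j) ∎
      where
      open SeriesReasoning
      qᵏ : Carrier
      qᵏ = pow q k

    f-dilate : ∀ k j → (f k ⊛ σ (pow q k) (f j)) ≈ₛ (pow q (j *ℕ k) • f (k +ℕ j))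
    f-dilate k j = begin
      f k ⊛ σ qᵏ (f j)                                  ≈⟨ ⊛-congʳ (f k) (σ-f k j) ⟩
      f k ⊛ (pow q (j *ℕ k) • (X^ j ⊛ Qc))             ≈⟨ ⊛-comm (f k) _ ⟩
      (pow q (j *ℕ k) • (X^ j ⊛ Qc)) ⊛ f k             ≈⟨ •-⊛ (pow q (j *ℕ k)) (X^ j ⊛ Qc) (f k) ⟩
      pow q (j *ℕ k) • ((X^ j ⊛ Qc) ⊛ f k)             ≈⟨ •-cong refl merge ⟩
      pow q (j *ℕ k) • f (k +ℕ j)                      ∎
      where
      open SeriesReasoning
      qᵏ : Carrier
      qᵏ = pow q k
      Qc : Series
      Qc = quot q (a * qᵏ) j (b * qᵏ) j
      merge : ((X^ j ⊛ Qc) ⊛ f k) ≈ₛ f (k +ℕ j)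
      merge = begin
        (X^ j ⊛ (poch q (a * qᵏ) j ⊛ pochInv q (b * qᵏ) j)) ⊛ (X^ k ⊛ (poch q a k ⊛ pochInv q b k))
          ≈⟨ S.solve 6 (λ xj pj ij xk pk ik → ((xj S.:* (pj S.:* ij)) S.:* (xk S.:* (pk S.:* ik)))
                          S.⊜ ((xk S.:* xj) S.:* ((pk S.:* pj) S.:* (ik S.:* ij))))
                       ≈ₛ-refl (X^ j) (poch q (a * qᵏ) j) (pochInv q (b * qᵏ) j) (X^ k) (poch q a k) (pochInv q b k) ⟩
        (X^ k ⊛ X^ j) ⊛ ((poch q a k ⊛ poch q (a * qᵏ) j) ⊛ (pochInv q b k ⊛ pochInv q (b * qᵏ) j))
          ≈⟨ ⊛-cong (≈ₛ-sym (X^-+ k j)) (⊛-cong (poch-+ a k j) (pochInv-+ b k j)) ⟩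
        f (k +ℕ j) ∎

-- Since f_n has order n and leading coefficient 1, every coefficient of
-- such a sum is a finite sum, and the coefficients D_n are unique.
module Expansions {c ℓ} (R : CommutativeRing c ℓ) (q a b : CommutativeRing.Carrier R) where
  open CommutativeRing R
  open PS R
  open FiniteSums R
  open PowerSeriesRing R
  open SeriesToolkit R
  open Pochhammer R q
  open Basis a b public
  open import Algebra.Properties.Group +-group using (∙-cancelˡ)

  expand : (ℕ → Carrier) → Series
  expand D = infSum (λ n → D n • f n)

  expand-cong : ∀ {D D′ : ℕ → Carrier} → (∀ n → D n ≈ D′ n) → expand D ≈ₛ expand D′
  expand-cong p = infSum-cong (λ n → •-cong (p n) ≈ₛ-refl)

  expand-+ : ∀ D E → expand (λ n → D n + E n) ≈ₛ (expand D ⊕ expand E)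
  expand-+ D E m = trans (sumR-cong′ (suc m) (λ n → distribʳ (f n m) (D n) (E n)))
                         (sumR-+ (suc m) (λ n → D n * f n m) (λ n → E n * f n m))

  •-expand : ∀ x D → (x • expand D) ≈ₛ expand (λ n → x * D n)
  •-expand x D = ≈ₛ-trans (•-infSum x (λ n → D n • f n)) (infSum-cong (λ n → •-assoc x (D n) (f n)))

  expand-injective : ∀ {D D′ : ℕ → Carrier} → expand D ≈ₛ expand D′ → ∀ n → D n ≈ D′ n
  expand-injective {D} {D′} p n = agreeBelow (suc n) n ℕₚ.≤-refl
    where
    leading : ∀ n → (∀ j → j < n → D j ≈ D′ j) → D n ≈ D′ n
    leading n below = begin
      D n               ≈⟨ *-identityʳ (D n) ⟨
      D n * 1#          ≈⟨ *-cong refl (f-diag n) ⟨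
      D n * f n n       ≈⟨ ∙-cancelˡ (sumR n (λ j → D′ j * f j n)) _ _ (trans (+-cong lower refl) (p n)) ⟩
      D′ n * f n n      ≈⟨ *-cong refl (f-diag n) ⟩
      D′ n * 1#         ≈⟨ *-identityʳ (D′ n) ⟩
      D′ n              ∎
      where
      open SetoidReasoning setoid
      lower : sumR n (λ j → D′ j * f j n) ≈ sumR n (λ j → D j * f j n)
      lower = sumR-cong n (λ j j<n → *-cong (sym (below j j<n)) refl)
    agreeBelow : ∀ N j → j < N → D j ≈ D′ j
    agreeBelow (suc N) j j<N+1 with ℕₚ.m≤n⇒m<n∨m≡n (ℕₚ.≤-pred j<N+1)
    ... | inj₁ j<N    = agreeBelow N j j<N
    ... | inj₂ ≡.refl = leading j (agreeBelow j)

  infSum-expand : (D : ℕ → ℕ → Carrier) → (∀ k n → n < k → D k n ≈ 0#) →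
                  infSum (λ k → expand (D k)) ≈ₛ expand (λ n → sumR (suc n) (λ k → D k n))
  infSum-expand D vanish m = begin
    sumR (suc m) (λ k → sumR (suc m) (λ n → D k n * f n m))
      ≈⟨ sumR-swap (suc m) (suc m) (λ k n → D k n * f n m) ⟩
    sumR (suc m) (λ n → sumR (suc m) (λ k → D k n * f n m))
      ≈⟨ sumR-cong (suc m) (λ n n≤m → trans (truncate n (ℕₚ.≤-pred n≤m)) (sym (sumR-*ʳ (suc n) (f n m) (λ k → D k n)))) ⟩
    sumR (suc m) (λ n → sumR (suc n) (λ k → D k n) * f n m) ∎
    where
    open SetoidReasoning setoid
    truncate : ∀ n → n ≤ m → sumR (suc m) (λ k → D k n * f n m) ≈ sumR (suc n) (λ k → D k n * f n m)
    truncate n n≤m = sumR-truncate (suc m) (λ k → D k n * f n m) (s≤s n≤m)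
      (λ k n<k _ → trans (*-cong (vanish k n n<k) refl) (zeroˡ _))

  expand-double : (w : ℕ → ℕ → Carrier) →
    infSum (λ k → infSum (λ j → w k j • f (k +ℕ j))) ≈ₛ expand (λ n → sumR (suc n) (λ k → w k (n ∸ k)))
  expand-double w m = sym (begin
    sumR (suc m) (λ n → sumR (suc n) (λ k → w k (n ∸ k)) * f n m)
      ≈⟨ sumR-cong′ (suc m) (λ n → sumR-*ʳ (suc n) (f n m) (λ k → w k (n ∸ k))) ⟩
    sumR (suc m) (λ n → sumR (suc n) (λ k → w k (n ∸ k) * f n m))
      ≈⟨ sumR-triangle m (λ k n → w k (n ∸ k) * f n m) ⟩
    sumR (suc m) (λ k → sumR (suc (m ∸ k)) (λ j → w k ((k +ℕ j) ∸ k) * f (k +ℕ j) m))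
      ≈⟨ sumR-cong (suc m) (λ k k≤m → trans (sumR-cong′ (suc (m ∸ k)) (reindex k))
                                            (sym (truncate k (ℕₚ.≤-pred k≤m)))) ⟩
    sumR (suc m) (λ k → sumR (suc m) (λ j → w k j * f (k +ℕ j) m)) ∎)
    where
    open SetoidReasoning setoid
    reindex : ∀ k j → w k ((k +ℕ j) ∸ k) * f (k +ℕ j) m ≈ w k j * f (k +ℕ j) m
    reindex k j = reflexive (≡.cong (λ i → w k i * f (k +ℕ j) m) (ℕₚ.m+n∸m≡n k j))
    -- f_{k+j} vanishes in degree m as soon as k + j > m
    truncate : ∀ k → k ≤ m → sumR (suc m) (λ j → w k j * f (k +ℕ j) m) ≈ sumR (suc (m ∸ k)) (λ j → w k j * f (k +ℕ j) m)
    truncate k k≤m = sumR-truncate (suc m) (λ j → w k j * f (k +ℕ j) m) (s≤s (ℕₚ.m∸n≤m m k))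
      (λ j m∸k<j _ → trans (*-cong refl (f-ord (k +ℕ j) m (beyond m∸k<j))) (zeroʳ _))
      where
      beyond : ∀ {j} → m ∸ k < j → m < k +ℕ j
      beyond m∸k<j = ℕₚ.≤-trans (s≤s (ℕₚ.≤-reflexive (≡.sym (ℕₚ.m+[n∸m]≡n k≤m)))) (ℕₚ.+-monoʳ-< k m∸k<j)

  -- The coefficients of t^k in the defining expansion of the B_{n,k}.
  column : (ℕ → ℕ → Carrier) → ℕ → ℕ → Carrier
  column B k n = if n <ᵇ k then 0# else B n k

  column-below : ∀ B {k n} → n < k → column B k n ≈ 0#
  column-below B {k} {n} n<k with n <ᵇ k | ℕₚ.<⇒<ᵇ n<k
  ... | true | _ = refl

  column-above : ∀ B {k n} → k ≤ n → column B k n ≈ B n k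
  column-above B {k} {n} k≤n with n <ᵇ k in n<ᵇk
  ... | false = refl
  ... | true  = ⊥-elim (ℕₚ.<⇒≱ (ℕₚ.<ᵇ⇒< n k (≡.subst T (≡.sym n<ᵇk) _)) k≤n)

  expansionTerm≈ : ∀ B k n → expansionTerm q a b B k n ≈ₛ (column B k n • f n)
  expansionTerm≈ B k n with n <ᵇ k
  ... | true  = λ m → trans (const-zero m) (sym (zeroˡ (f n m)))
  ... | false = ≈ₛ-refl

  fromIsBExpansion : ∀ B → IsBExpansion q a b B → ∀ k → X^ k ≈ₛ expand (column B k)
  fromIsBExpansion B hyp k = ≈ₛ-trans (hyp k) (infSum-cong (expansionTerm≈ B k))

  toIsBExpansion : ∀ B → (∀ k → X^ k ≈ₛ expand (column B k)) → IsBExpansion q a b B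
  toIsBExpansion B hyp k = ≈ₛ-trans (hyp k) (infSum-cong (λ n → ≈ₛ-sym (expansionTerm≈ B k n)))

module GeometricExpansion {c ℓ} (R : CommutativeRing c ℓ) (q a b : CommutativeRing.Carrier R)
       (B : ℕ → ℕ → CommutativeRing.Carrier R) (hyp : PS.IsBExpansion R q a b B) where
  open CommutativeRing R
  open PS R
  open FiniteSums R
  open PowerSeriesRing R
  open SeriesToolkit R
  open Expansions R q a b
  open import Algebra.Properties.Group +-group using (ε⁻¹≈ε)

  L : ℕ → Carrier
  L n = sumR (suc n) (B n)

  G-expansion : G ≈ₛ expand L
  G-expansion = begin
    G                                                    ≈⟨ G-as-sum ⟨
    infSum X^                                            ≈⟨ infSum-cong (fromIsBExpansion B hyp) ⟩
    infSum (λ k → expand (column B k))                   ≈⟨ infSum-expand (column B) (λ k n → column-below B) ⟩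
    expand (λ n → sumR (suc n) (λ k → column B k n))     ≈⟨ expand-cong columnSum ⟩
    expand L                                             ∎
    where
    open SeriesReasoning
    columnSum : ∀ n → sumR (suc n) (λ k → column B k n) ≈ L n
    columnSum n = sumR-cong (suc n) (λ k k≤n → column-above B (ℕₚ.≤-pred k≤n))

  -- t = Σ_j B_{j,1} f_j;  dilating by q^k and multiplying by f_k (see f-dilate):
  --   q^k t f_k = Σ_j B_{j,1} q^{jk} f_{k+j}
  qᵏtf-expansion : ∀ k → (pow q k • (X ⊛ f k)) ≈ₛ infSum (λ j → (column B 1 j * pow q (j *ℕ k)) • f (k +ℕ j))
  qᵏtf-expansion k = begin
    pow q k • (X ⊛ f k)                                  ≈⟨ •-⊛ (pow q k) X (f k) ⟨
    (pow q k • X) ⊛ f k                                  ≈⟨ ⊛-congˡ (f k) (≈ₛ-trans (•-cong (sym (*-identityʳ qᵏ)) ≈ₛ-refl) (≈ₛ-sym (σ-X^ qᵏ 1))) ⟩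
    σ qᵏ X ⊛ f k                                         ≈⟨ ⊛-comm (σ qᵏ X) (f k) ⟩
    f k ⊛ σ qᵏ X                                         ≈⟨ ⊛-congʳ (f k) (σ-cong qᵏ (fromIsBExpansion B hyp 1)) ⟩
    f k ⊛ σ qᵏ (expand (column B 1))                     ≈⟨ ⊛-congʳ (f k) (σ-infSum qᵏ (λ j → column B 1 j • f j)) ⟩
    f k ⊛ infSum (λ j → σ qᵏ (column B 1 j • f j))       ≈⟨ ⊛-infSum (f k) _ (λ j → σ-ord j qᵏ _ (ord-• j _ (f j) (f-ord j))) ⟩
    infSum (λ j → f k ⊛ σ qᵏ (column B 1 j • f j))       ≈⟨ infSum-cong termwise ⟩
    infSum (λ j → (column B 1 j * pow q (j *ℕ k)) • f (k +ℕ j)) ∎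
    where
    open SeriesReasoning
    qᵏ : Carrier
    qᵏ = pow q k
    termwise : ∀ j → (f k ⊛ σ qᵏ (column B 1 j • f j)) ≈ₛ ((column B 1 j * pow q (j *ℕ k)) • f (k +ℕ j))
    termwise j = begin
      f k ⊛ σ qᵏ (column B 1 j • f j)              ≈⟨ ⊛-congʳ (f k) (σ-• qᵏ (column B 1 j) (f j)) ⟩
      f k ⊛ (column B 1 j • σ qᵏ (f j))            ≈⟨ ⊛-comm (f k) _ ⟩
      (column B 1 j • σ qᵏ (f j)) ⊛ f k            ≈⟨ •-⊛ (column B 1 j) (σ qᵏ (f j)) (f k) ⟩
      column B 1 j • (σ qᵏ (f j) ⊛ f k)            ≈⟨ •-cong refl (≈ₛ-trans (⊛-comm _ (f k)) (f-dilate k j)) ⟩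
      column B 1 j • (pow q (j *ℕ k) • f (k +ℕ j)) ≈⟨ •-assoc (column B 1 j) (pow q (j *ℕ k)) (f (k +ℕ j)) ⟩
      (column B 1 j * pow q (j *ℕ k)) • f (k +ℕ j) ∎

  -- β n is the parameter of the last factor of (b t;q)_n  (β 0 = 0 for n = 0).
  β : ℕ → Carrier
  β zero    = 0#
  β (suc n) = b * pow q n

  module Telescoping (d : ℕ → Carrier) (d-zero : d 0 ≈ 1#)
                     (d-rec : ∀ n → d (suc n) * (1# - a * pow q n) ≈ d n * (1# - β n)) where

    C : ℕ → Carrier
    C n = sumR n (λ k → B (n ∸ k) 1 * pow q ((n ∸ k) *ℕ k) * d (suc k))

    -- remainder_n = d_n f_n (1 - β_n t)/(1 - t)  has order n
    remainder : ℕ → Series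
    remainder n = d n • (f n ⊛ (oneMinus (β n) ⊛ G))

    correction : ℕ → Series
    correction n = a • (d (suc n) • (pow q n • (X ⊛ f n)))

    remainder-zero : remainder 0 ≈ₛ G
    remainder-zero = begin
      d 0 • (f 0 ⊛ (oneMinus 0# ⊛ G))         ≈⟨ •-cong d-zero (⊛-cong f-zero (⊛-congˡ G oneMinus-zero)) ⟩
      1# • (const 1# ⊛ (const 1# ⊛ G))        ≈⟨ •-cong refl (≈ₛ-trans (⊛-identityˡ _) (⊛-identityˡ G)) ⟩
      1# • G                                  ≈⟨ (λ m → *-identityˡ (G m)) ⟩
      G                                       ∎
      where
      open SeriesReasoning
      f-zero : f 0 ≈ₛ const 1#
      f-zero = ≈ₛ-trans (⊛-congˡ (Q 0) X^-zero) (≈ₛ-trans (⊛-identityˡ (Q 0)) (⊛-identityˡ (const 1#)))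
      oneMinus-zero : oneMinus 0# ≈ₛ const 1#
      oneMinus-zero zero          = refl
      oneMinus-zero (suc zero)    = ε⁻¹≈ε
      oneMinus-zero (suc (suc m)) = refl

    remainder-ord : ∀ n → Ord n (remainder n)
    remainder-ord n = ord-• n (d n) _ (ord-⊛ n (f n) (oneMinus (β n) ⊛ G) (f-ord n))

    recurrence-split : ∀ n → d n * (1# - β n) + a * (d (suc n) * pow q n) ≈ d (suc n)
    recurrence-split n = begin
      d n * (1# - β n) + a * (d (suc n) * pow q n)     ≈⟨ +-cong (sym (d-rec n)) (x∙yz≈y∙xz a (d (suc n)) (pow q n)) ⟩
      d (suc n) * (1# - α) + d (suc n) * α             ≈⟨ distribˡ (d (suc n)) _ _ ⟨
      d (suc n) * ((1# - α) + α)                       ≈⟨ *-cong refl (trans (+-assoc _ _ _) (trans (+-cong refl (-‿inverseˡ α)) (+-identityʳ _))) ⟩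
      d (suc n) * 1#                                   ≈⟨ *-identityʳ (d (suc n)) ⟩
      d (suc n)                                        ∎
      where
      open SetoidReasoning setoid
      open CommSemigroupProperties *-commutativeSemigroup using (x∙yz≈y∙xz)
      α : Carrier
      α = a * pow q n

    remainder-step : ∀ n → (remainder n ⊕ correction n) ≈ₛ ((d n • f n) ⊕ remainder (suc n))
    remainder-step n = ≈ₛ-trans lhs (≈ₛ-sym rhs)
      where
      open SeriesReasoning
      α κ : Carrier
      α = a * pow q n
      κ = d n * (1# - β n)
      F D₀ D₁ Cα Cβ K Aw normalForm : Series
      F  = f n
      D₀ = const (d n)
      D₁ = const (d (suc n))
      Cα = const (1# - α)
      Cβ = const (1# - β n)
      K  = const κ
      Aw = const (a * (d (suc n) * pow q n))
      normalForm = (D₀ ⊛ F) ⊕ ((D₁ ⊛ (X ⊛ F)) ⊕ (K ⊛ (X ⊛ (X ⊛ (F ⊛ G)))))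
      correction-const : correction n ≈ₛ (Aw ⊛ (X ⊛ F))
      correction-const = ≈ₛ-trans (•-cong refl (•-assoc (d (suc n)) (pow q n) (X ⊛ F)))
        (≈ₛ-trans (•-assoc a (d (suc n) * pow q n) (X ⊛ F)) (≈ₛ-sym (const⊛≈• _ (X ⊛ F))))
      κ+Aw : (K ⊕ Aw) ≈ₛ D₁
      κ+Aw = ≈ₛ-trans (const-+ κ _) (const-cong (recurrence-split n))
      lhs : (remainder n ⊕ correction n) ≈ₛ normalForm
      lhs = begin
        (d n • (F ⊛ (oneMinus (β n) ⊛ G))) ⊕ correction n
          ≈⟨ ⊕-cong (≈ₛ-trans (≈ₛ-sym (const⊛≈• (d n) _)) (⊛-congʳ D₀ (⊛-congʳ F
                       (≈ₛ-trans (oneMinus-G (β n)) (⊕-cong ≈ₛ-refl (⊛-congʳ Cβ (⊛-congʳ X G-rec)))))))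
                    correction-const ⟩
        (D₀ ⊛ (F ⊛ (const 1# ⊕ (Cβ ⊛ (X ⊛ (const 1# ⊕ (X ⊛ G))))))) ⊕ (Aw ⊛ (X ⊛ F))
          ≈⟨ S.solve 6 (λ d₀ f cβ x g aw →
                 ((d₀ S.:* (f S.:* (S.con 1 S.:+ (cβ S.:* (x S.:* (S.con 1 S.:+ (x S.:* g))))))) S.:+ (aw S.:* (x S.:* f)))
               S.⊜ ((d₀ S.:* f) S.:+ ((((d₀ S.:* cβ) S.:+ aw) S.:* (x S.:* f)) S.:+ ((d₀ S.:* cβ) S.:* (x S.:* (x S.:* (f S.:* g)))))))
               ≈ₛ-refl D₀ F Cβ X G Aw ⟩
        (D₀ ⊛ F) ⊕ ((((D₀ ⊛ Cβ) ⊕ Aw) ⊛ (X ⊛ F)) ⊕ ((D₀ ⊛ Cβ) ⊛ (X ⊛ (X ⊛ (F ⊛ G)))))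
          ≈⟨ ⊕-cong (≈ₛ-refl {D₀ ⊛ F}) (⊕-cong (⊛-congˡ (X ⊛ F) (≈ₛ-trans (⊕-cong (const-* (d n) _) ≈ₛ-refl) κ+Aw))
                                               (⊛-congˡ (X ⊛ (X ⊛ (F ⊛ G))) (const-* (d n) _))) ⟩
        normalForm ∎
      rhs : ((d n • F) ⊕ remainder (suc n)) ≈ₛ normalForm
      rhs = begin
        (d n • F) ⊕ (d (suc n) • (f (suc n) ⊛ (oneMinus (β (suc n)) ⊛ G)))
          ≈⟨ ⊕-cong (≈ₛ-sym (const⊛≈• (d n) F)) (≈ₛ-sym (const⊛≈• (d (suc n)) _)) ⟩
        (D₀ ⊛ F) ⊕ (D₁ ⊛ (f (suc n) ⊛ (oneMinus (β (suc n)) ⊛ G)))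
          ≈⟨ ⊕-cong (≈ₛ-refl {D₀ ⊛ F}) (⊛-congʳ D₁ (S.solve 3 (λ f o g → (f S.:* (o S.:* g)) S.⊜ ((o S.:* f) S.:* g))
                                                               ≈ₛ-refl (f (suc n)) (oneMinus (β (suc n))) G)) ⟩
        (D₀ ⊛ F) ⊕ (D₁ ⊛ ((oneMinus (β (suc n)) ⊛ f (suc n)) ⊛ G))
          ≈⟨ ⊕-cong (≈ₛ-refl {D₀ ⊛ F}) (⊛-congʳ D₁ (≈ₛ-trans (⊛-congˡ G (f-rec n)) (⊛-assoc (X ⊛ F) _ G))) ⟩
        (D₀ ⊛ F) ⊕ (D₁ ⊛ ((X ⊛ F) ⊛ (oneMinus α ⊛ G)))
          ≈⟨ ⊕-cong (≈ₛ-refl {D₀ ⊛ F}) (⊛-congʳ D₁ (⊛-congʳ (X ⊛ F) (oneMinus-G α))) ⟩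
        (D₀ ⊛ F) ⊕ (D₁ ⊛ ((X ⊛ F) ⊛ (const 1# ⊕ (Cα ⊛ (X ⊛ G)))))
          ≈⟨ S.solve 6 (λ d₀ f d₁ x cα g →
                 ((d₀ S.:* f) S.:+ (d₁ S.:* ((x S.:* f) S.:* (S.con 1 S.:+ (cα S.:* (x S.:* g))))))
               S.⊜ ((d₀ S.:* f) S.:+ ((d₁ S.:* (x S.:* f)) S.:+ ((d₁ S.:* cα) S.:* (x S.:* (x S.:* (f S.:* g)))))))
               ≈ₛ-refl D₀ F D₁ X Cα G ⟩
        (D₀ ⊛ F) ⊕ ((D₁ ⊛ (X ⊛ F)) ⊕ ((D₁ ⊛ Cα) ⊛ (X ⊛ (X ⊛ (F ⊛ G)))))
          ≈⟨ ⊕-cong (≈ₛ-refl {D₀ ⊛ F}) (⊕-cong (≈ₛ-refl {D₁ ⊛ (X ⊛ F)})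
               (⊛-congˡ (X ⊛ (X ⊛ (F ⊛ G))) (≈ₛ-trans (const-* (d (suc n)) _) (const-cong (d-rec n))))) ⟩
        normalForm ∎

    d-expansion : expand d ≈ₛ (G ⊕ infSum correction)
    d-expansion m = begin
      sumR (suc m) (λ n → d n * f n m)                                ≈⟨ +-identityʳ _ ⟨
      sumR (suc m) (λ n → d n * f n m) + 0#                           ≈⟨ +-cong refl (remainder-ord (suc m) m ℕₚ.≤-refl) ⟨
      sumR (suc m) (λ n → d n * f n m) + remainder (suc m) m          ≈⟨ telescope (λ n → remainder n m) (λ n → d n * f n m)
                                                                            (λ n → correction n m) (λ n → remainder-step n m) (suc m) ⟨
      remainder 0 m + sumR (suc m) (λ n → correction n m)             ≈⟨ +-cong (remainder-zero m) refl ⟩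
      G m + sumR (suc m) (λ n → correction n m)                       ∎
      where open SetoidReasoning setoid

    -- by qᵏtf-expansion the corrections regroup into Σ_n a C_n f_n
    correction-expansion : infSum correction ≈ₛ expand (λ n → a * C n)
    correction-expansion = begin
      infSum correction
        ≈⟨ •-infSum a (λ k → d (suc k) • (pow q k • (X ⊛ f k))) ⟨
      a • infSum (λ k → d (suc k) • (pow q k • (X ⊛ f k)))
        ≈⟨ •-cong refl (infSum-cong (λ k → •-cong refl (qᵏtf-expansion k))) ⟩
      a • infSum (λ k → d (suc k) • infSum (λ j → (column B 1 j * pow q (j *ℕ k)) • f (k +ℕ j)))
        ≈⟨ •-cong refl (infSum-cong (λ k → ≈ₛ-trans (•-infSum (d (suc k)) _)
                                              (infSum-cong (λ j → •-assoc (d (suc k)) _ (f (k +ℕ j)))))) ⟩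
      a • infSum (λ k → infSum (λ j → w k j • f (k +ℕ j)))
        ≈⟨ •-cong refl (expand-double w) ⟩
      a • expand (λ n → sumR (suc n) (λ k → w k (n ∸ k)))
        ≈⟨ •-cong refl (expand-cong diagonalSum) ⟩
      a • expand C
        ≈⟨ •-expand a C ⟩
      expand (λ n → a * C n) ∎
      where
      open SeriesReasoning
      w : ℕ → ℕ → Carrier
      w k j = d (suc k) * (column B 1 j * pow q (j *ℕ k))
      -- the term k = n vanishes because column B 1 0 = 0
      diagonalSum : ∀ n → sumR (suc n) (λ k → w k (n ∸ k)) ≈ C n
      diagonalSum n = trans (+-cong (sumR-cong n term) last) (+-identityʳ (C n))
        where
        open CommSemigroupProperties *-commutativeSemigroup using (x∙yz≈yz∙x)
        term : ∀ k → k < n → w k (n ∸ k) ≈ B (n ∸ k) 1 * pow q ((n ∸ k) *ℕ k) * d (suc k)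
        term k k<n = trans (*-cong refl (*-cong (column-above B (ℕₚ.m<n⇒0<n∸m k<n)) refl))
                           (x∙yz≈yz∙x (d (suc k)) _ _)
        last : w n (n ∸ n) ≈ 0#
        last rewrite ℕₚ.n∸n≡0 n = trans (*-cong refl (zeroˡ _)) (zeroʳ _)

    coefficients : ∀ n → L n + a * C n ≈ d n
    coefficients = expand-injective (begin
      expand (λ n → L n + a * C n)               ≈⟨ expand-+ L (λ n → a * C n) ⟩
      expand L ⊕ expand (λ n → a * C n)          ≈⟨ ⊕-cong (≈ₛ-sym G-expansion) (≈ₛ-sym correction-expansion) ⟩
      G ⊕ infSum correction                      ≈⟨ d-expansion ⟨
      expand d                                   ∎)
      where open SeriesReasoning

-- The substitution  t ↦ w t  from R[[t]] into R[[w]][[t]], obtained by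
-- embedding coefficients as constants of R[[w]] and dilating by w.
-- Series over R[[w]] are written with the prefix W.
module Substitution {c ℓ} (R : CommutativeRing c ℓ) (q : CommutativeRing.Carrier R) where
  open CommutativeRing R
  open PS R
  open PowerSeriesRing R
  open SeriesToolkit R
  open Pochhammer R q
  open import Algebra.Properties.Group +-group using (ε⁻¹≈ε)
  module W  = PS seriesRing
  module WF = FiniteSums seriesRing
  module WR = PowerSeriesRing seriesRing
  module WT = SeriesToolkit seriesRing
  module WP = Pochhammer seriesRing (const q)

  const-sumR : ∀ n (h : ℕ → Carrier) → const (sumR n h) ≈ₛ W.sumR n (λ i → const (h i))
  const-sumR zero    h = ≈ₛ-refl
  const-sumR (suc n) h = ≈ₛ-trans (≈ₛ-sym (const-+ (sumR n h) (h n))) (⊕-cong (const-sumR n h) ≈ₛ-refl)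

  pow-const : ∀ x n → W.pow (const x) n ≈ₛ const (pow x n)
  pow-const x zero    = ≈ₛ-refl
  pow-const x (suc n) = ≈ₛ-trans (⊛-congʳ (const x) (pow-const x n)) (const-* x (pow x n))

  ι : Series → W.Series
  ι f m = const (f m)

  ι-cong : ∀ {f g} → f ≈ₛ g → ι f W.≈ₛ ι g
  ι-cong p m = const-cong (p m)

  ι-⊛ : ∀ f g → ι (f ⊛ g) W.≈ₛ (ι f W.⊛ ι g)
  ι-⊛ f g m = ≈ₛ-trans (const-sumR (suc m) (λ i → f i * g (m ∸ i)))
                       (WF.sumR-cong′ (suc m) (λ i → ≈ₛ-sym (const-* (f i) (g (m ∸ i)))))

  ι-• : ∀ x f → ι (x • f) W.≈ₛ (const x W.• ι f)
  ι-• x f m = ≈ₛ-sym (const-* x (f m))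

  ι-X^ : ∀ n → ι (X^ n) W.≈ₛ W.X^ n
  ι-X^ zero    zero    = ≈ₛ-refl
  ι-X^ zero    (suc m) = ≈ₛ-refl
  ι-X^ (suc n) zero    = ≈ₛ-refl
  ι-X^ (suc n) (suc m) = ι-X^ n m

  ι-infSum : ∀ F → ι (infSum F) W.≈ₛ W.infSum (λ n → ι (F n))
  ι-infSum F m = const-sumR (suc m) (λ n → F n m)

  ι-const : ∀ x → ι (const x) W.≈ₛ W.const (const x)
  ι-const x zero    = ≈ₛ-refl
  ι-const x (suc m) = ≈ₛ-refl

  ι-oneMinus : ∀ x → ι (oneMinus x) W.≈ₛ W.oneMinus (const x)
  ι-oneMinus x zero          = ≈ₛ-refl
  ι-oneMinus x (suc zero)    = λ { zero → refl ; (suc m) → sym ε⁻¹≈ε }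
  ι-oneMinus x (suc (suc m)) = ≈ₛ-refl

  ι-geom : ∀ x → ι (geom x) W.≈ₛ W.geom (const x)
  ι-geom x m = ≈ₛ-sym (pow-const x m)

  const-q^ : ∀ x n → const (x * pow q n) ≈ₛ (const x ⊛ W.pow (const q) n)
  const-q^ x n = ≈ₛ-sym (≈ₛ-trans (⊛-congʳ (const x) (pow-const q n)) (const-* x (pow q n)))

  ι-poch : ∀ x n → ι (poch q x n) W.≈ₛ W.poch (const q) (const x) n
  ι-poch x zero    = ι-const 1#
  ι-poch x (suc n) = WR.≈ₛ-trans (ι-⊛ (poch q x n) (oneMinus (x * pow q n)))
    (WR.⊛-cong (ι-poch x n) (WR.≈ₛ-trans (ι-oneMinus (x * pow q n)) (WT.oneMinus-cong (const-q^ x n))))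

  ι-pochInv : ∀ x n → ι (pochInv q x n) W.≈ₛ W.pochInv (const q) (const x) n
  ι-pochInv x zero    = ι-const 1#
  ι-pochInv x (suc n) = WR.≈ₛ-trans (ι-⊛ (pochInv q x n) (geom (x * pow q n)))
    (WR.⊛-cong (ι-pochInv x n) (WR.≈ₛ-trans (ι-geom (x * pow q n)) (WT.geom-cong (const-q^ x n))))

  Φ : Series → W.Series
  Φ f = WT.σ X (ι f)

  Φ-cong : ∀ {f g} → f ≈ₛ g → Φ f W.≈ₛ Φ g
  Φ-cong p = WT.σ-cong X (ι-cong p)

  pow-X : ∀ n → W.pow X n ≈ₛ X^ n
  pow-X zero    = ≈ₛ-sym X^-zero
  pow-X (suc n) = ≈ₛ-trans (⊛-congʳ X (pow-X n)) (≈ₛ-sym (X^-+ 1 n))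

  Φ-X^ : ∀ n → Φ (X^ n) W.≈ₛ (X^ n W.• W.X^ n)
  Φ-X^ n = WR.≈ₛ-trans (WT.σ-cong X (ι-X^ n))
             (WR.≈ₛ-trans (WT.σ-X^ X n) (WT.•-cong (pow-X n) (WR.≈ₛ-refl {W.X^ n})))

  module Transfer (a b : Carrier) where
    module E  = Expansions R q a b
    module E′ = Expansions seriesRing (const q) (a • X) (b • X)

    ι-quot : ∀ x m y l → ι (quot q x m y l) W.≈ₛ W.quot (const q) (const x) m (const y) l
    ι-quot x m y l = WR.≈ₛ-trans (ι-⊛ (poch q x m) (pochInv q y l)) (WR.⊛-cong (ι-poch x m) (ι-pochInv y l))

    Φ-f : ∀ n → Φ (E.f n) W.≈ₛ (X^ n W.• E′.f n)
    Φ-f n = begin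
      WT.σ X (ι (X^ n ⊛ quot q a n b n))
        ≈⟨ WT.σ-cong X (WR.≈ₛ-trans (ι-⊛ (X^ n) (quot q a n b n)) (WR.⊛-cong (ι-X^ n) (ι-quot a n b n))) ⟩
      WT.σ X (W.X^ n W.⊛ (W.poch q′ (const a) n W.⊛ W.pochInv q′ (const b) n))
        ≈⟨ WR.≈ₛ-trans (WT.σ-⊛ X (W.X^ n) (W.poch q′ (const a) n W.⊛ W.pochInv q′ (const b) n))
             (WR.⊛-congʳ (WT.σ X (W.X^ n)) (WT.σ-⊛ X (W.poch q′ (const a) n) (W.pochInv q′ (const b) n))) ⟩
      WT.σ X (W.X^ n) W.⊛ (WT.σ X (W.poch q′ (const a) n) W.⊛ WT.σ X (W.pochInv q′ (const b) n))
        ≈⟨ WR.⊛-congʳ (WT.σ X (W.X^ n)) (WR.⊛-cong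
             (WR.≈ₛ-trans (WP.σ-poch X (const a) n) (WP.poch-cong n (const⊛≈• a X)))
             (WR.≈ₛ-trans (WP.σ-pochInv X (const b) n) (WP.pochInv-cong n (const⊛≈• b X)))) ⟩
      WT.σ X (W.X^ n) W.⊛ W.quot q′ (a • X) n (b • X) n
        ≈⟨ WR.⊛-congˡ (W.quot q′ (a • X) n (b • X) n) (WT.σ-X^ X n) ⟩
      (W.pow X n W.• W.X^ n) W.⊛ W.quot q′ (a • X) n (b • X) n
        ≈⟨ WT.•-⊛ (W.pow X n) (W.X^ n) (W.quot q′ (a • X) n (b • X) n) ⟩
      W.pow X n W.• E′.f n
        ≈⟨ WT.•-cong (pow-X n) (WR.≈ₛ-refl {E′.f n}) ⟩
      X^ n W.• E′.f n ∎
      where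
      open WR.SeriesReasoning
      q′ : Series
      q′ = const q

    Φ-expand : ∀ D → Φ (E.expand D) W.≈ₛ E′.expand (λ n → D n • X^ n)
    Φ-expand D = begin
      WT.σ X (ι (infSum (λ n → D n • E.f n)))
        ≈⟨ WT.σ-cong X (ι-infSum (λ n → D n • E.f n)) ⟩
      WT.σ X (W.infSum (λ n → ι (D n • E.f n)))
        ≈⟨ WT.σ-infSum X (λ n → ι (D n • E.f n)) ⟩
      W.infSum (λ n → WT.σ X (ι (D n • E.f n)))
        ≈⟨ WT.infSum-cong termwise ⟩
      W.infSum (λ n → (D n • X^ n) W.• E′.f n) ∎
      where
      open WR.SeriesReasoning
      termwise : ∀ n → WT.σ X (ι (D n • E.f n)) W.≈ₛ ((D n • X^ n) W.• E′.f n)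
      termwise n = begin
        WT.σ X (ι (D n • E.f n))              ≈⟨ WT.σ-cong X (ι-• (D n) (E.f n)) ⟩
        WT.σ X (const (D n) W.• ι (E.f n))    ≈⟨ WT.σ-• X (const (D n)) (ι (E.f n)) ⟩
        const (D n) W.• Φ (E.f n)             ≈⟨ WT.•-cong ≈ₛ-refl (Φ-f n) ⟩
        const (D n) W.• (X^ n W.• E′.f n)     ≈⟨ WT.•-assoc (const (D n)) (X^ n) (E′.f n) ⟩
        (const (D n) ⊛ X^ n) W.• E′.f n       ≈⟨ WT.•-cong (const⊛≈• (D n) (X^ n)) (WR.≈ₛ-refl {E′.f n}) ⟩
        (D n • X^ n) W.• E′.f n               ∎

-- Corollary 2.1: the main computation over R[[w]] for the parameters
-- (q, a w, b w), with B′_{n,k} = B_{n,k} w^{n-k} and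
-- d_0 = 1,  d_{n+1} = (b w;q)_n / (a w;q)_{n+1}.
module Corollary {c ℓ} (R : CommutativeRing c ℓ) (q a b : CommutativeRing.Carrier R)
       (B : ℕ → ℕ → CommutativeRing.Carrier R) (hyp : PS.IsBExpansion R q a b B) where
  open CommutativeRing R
  open PS R
  open FiniteSums R
  open PowerSeriesRing R
  open SeriesToolkit R
  open Pochhammer R q
  open Substitution R q
  open Transfer a b
  open import Algebra.Properties.Group +-group using (ε⁻¹≈ε)

  B′ : ℕ → ℕ → Series
  B′ n k = B n k • X^ (n ∸ k)

  shiftColumn : ∀ k n → (E.column B k n • X^ n) ≈ₛ (X^ k ⊛ E′.column B′ k n)
  shiftColumn k n with n ℕₚ.<? k
  ... | yes n<k = ≈ₛ-trans (•-cong (E.column-below B n<k) ≈ₛ-refl)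
                    (≈ₛ-trans (λ m → trans (zeroˡ (X^ n m)) (sym (const-zero m)))
                      (≈ₛ-sym (≈ₛ-trans (⊛-congʳ (X^ k) (E′.column-below B′ n<k))
                                         (CommutativeRing.zeroʳ seriesRing (X^ k)))))
  ... | no n≮k = begin
    E.column B k n • X^ n           ≈⟨ •-cong (E.column-above B k≤n) (≈ₛ-trans (X^-cong (≡.sym (ℕₚ.m+[n∸m]≡n k≤n))) (X^-+ k (n ∸ k))) ⟩
    B n k • (X^ k ⊛ X^ (n ∸ k))     ≈⟨ •-cong refl (⊛-comm (X^ k) (X^ (n ∸ k))) ⟩
    B n k • (X^ (n ∸ k) ⊛ X^ k)     ≈⟨ •-⊛ (B n k) (X^ (n ∸ k)) (X^ k) ⟨
    (B n k • X^ (n ∸ k)) ⊛ X^ k     ≈⟨ ⊛-comm (B n k • X^ (n ∸ k)) (X^ k) ⟩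
    X^ k ⊛ B′ n k                   ≈⟨ ⊛-congʳ (X^ k) (E′.column-above B′ k≤n) ⟨
    X^ k ⊛ E′.column B′ k n         ∎
    where
    open SeriesReasoning
    k≤n : k ≤ n
    k≤n = ℕₚ.≮⇒≥ n≮k
    X^-cong : ∀ {i j} → i ≡.≡ j → X^ i ≈ₛ X^ j
    X^-cong ≡.refl = ≈ₛ-refl

  -- the B′_{n,k} are the B-coefficients for (q, a w, b w): substitute t ↦ w t
  -- in the defining expansion of t^k and cancel w^k
  hyp′ : W.IsBExpansion (const q) (a • X) (b • X) B′
  hyp′ = E′.toIsBExpansion B′ (λ k m → X^-cancel k (expansionOfX^ k m))
    where
    open WR.SeriesReasoning
    expansionOfX^ : ∀ k → (X^ k W.• W.X^ k) W.≈ₛ (X^ k W.• E′.expand (E′.column B′ k))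
    expansionOfX^ k = begin
      X^ k W.• W.X^ k                                  ≈⟨ Φ-X^ k ⟨
      Φ (X^ k)                                         ≈⟨ Φ-cong (E.fromIsBExpansion B hyp k) ⟩
      Φ (E.expand (E.column B k))                      ≈⟨ Φ-expand (E.column B k) ⟩
      E′.expand (λ n → E.column B k n • X^ n)          ≈⟨ E′.expand-cong (shiftColumn k) ⟩
      E′.expand (λ n → X^ k ⊛ E′.column B′ k n)        ≈⟨ E′.•-expand (X^ k) (E′.column B′ k) ⟨
      X^ k W.• E′.expand (E′.column B′ k)              ∎

  module G′ = GeometricExpansion seriesRing (const q) (a • X) (b • X) B′ hyp′

  oneMinus-w : ∀ x n → (const 1# ⊕ (⊝ ((x • X) ⊛ W.pow (const q) n))) ≈ₛ oneMinus (x * pow q n)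
  oneMinus-w x n = ≈ₛ-trans (⊕-cong (≈ₛ-refl {const 1#}) (λ m → -‿cong (scaled m))) (coefficient (x * pow q n))
    where
    scaled : ((x • X) ⊛ W.pow (const q) n) ≈ₛ ((x * pow q n) • X)
    scaled = ≈ₛ-trans (⊛-congʳ (x • X) (pow-const q n))
               (≈ₛ-trans (⊛-comm (x • X) (const (pow q n)))
                 (≈ₛ-trans (const⊛≈• (pow q n) (x • X))
                   (≈ₛ-trans (•-assoc (pow q n) x X) (•-cong (*-comm (pow q n) x) ≈ₛ-refl))))
    coefficient : ∀ y → (const 1# ⊕ (⊝ (y • X))) ≈ₛ oneMinus y
    coefficient y zero          = trans (+-cong refl (trans (-‿cong (zeroʳ y)) ε⁻¹≈ε)) (+-identityʳ 1#)
    coefficient y (suc zero)    = trans (+-identityˡ _) (-‿cong (*-identityʳ y))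
    coefficient y (suc (suc m)) = trans (+-identityˡ _) (trans (-‿cong (zeroʳ y)) ε⁻¹≈ε)

  d′ : ℕ → Series
  d′ zero    = const 1#
  d′ (suc n) = quot q b n a (suc n)

  -- both sides of the recurrence for d′ equal (b w;q)_n / (a w;q)_n
  d′-rec : ∀ n → (d′ (suc n) ⊛ (const 1# ⊕ (⊝ ((a • X) ⊛ W.pow (const q) n))))
                 ≈ₛ (d′ n ⊛ (const 1# ⊕ (⊝ G′.β n)))
  d′-rec n = ≈ₛ-trans (≈ₛ-trans (⊛-congʳ (d′ (suc n)) (oneMinus-w a n)) (quot-denominator b n a n))
                      (≈ₛ-sym (lastFactor n))
    where
    lastFactor : ∀ n → (d′ n ⊛ (const 1# ⊕ (⊝ G′.β n))) ≈ₛ quot q b n a n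
    lastFactor zero    = ⊛-congʳ (const 1#) one-zero
      where
      one-zero : (const 1# ⊕ (⊝ const 0#)) ≈ₛ const 1#
      one-zero m = trans (+-cong refl (trans (-‿cong (const-zero m)) ε⁻¹≈ε)) (+-identityʳ _)
    lastFactor (suc n) = ≈ₛ-trans (⊛-congʳ (d′ (suc n)) (oneMinus-w b n)) (quot-numerator b n a (suc n))

  module T = G′.Telescoping d′ ≈ₛ-refl d′-rec

  sumR-series : ∀ N (F : ℕ → Series) → W.sumR N F ≈ₛ sumS N F
  sumR-series zero    F m = const-zero m
  sumR-series (suc N) F m = +-cong (sumR-series N F m) refl

  weightedTerm : ∀ j e D → ((a • X) ⊛ ((B′ (suc j) 1 ⊛ W.pow (const q) e) ⊛ D))
                           ≈ₛ (a • ((B (suc j) 1 * pow q e) • (X^ (suc j) ⊛ D)))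
  weightedTerm j e D = begin
    (a • X) ⊛ (((β • X^ j) ⊛ W.pow (const q) e) ⊛ D)
      ≈⟨ ⊛-cong (≈ₛ-sym (const⊛≈• a X)) (⊛-congˡ D (⊛-cong (≈ₛ-sym (const⊛≈• β (X^ j))) (pow-const q e))) ⟩
    (const a ⊛ X) ⊛ (((const β ⊛ X^ j) ⊛ const (pow q e)) ⊛ D)
      ≈⟨ S.solve 6 (λ ca x cβ xj cq d → ((ca S.:* x) S.:* (((cβ S.:* xj) S.:* cq) S.:* d))
                                          S.⊜ (ca S.:* ((cβ S.:* cq) S.:* ((x S.:* xj) S.:* d))))
                   ≈ₛ-refl (const a) X (const β) (X^ j) (const (pow q e)) D ⟩
    const a ⊛ ((const β ⊛ const (pow q e)) ⊛ ((X ⊛ X^ j) ⊛ D))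
      ≈⟨ ⊛-congʳ (const a) (⊛-cong (const-* β (pow q e)) (⊛-congˡ D (≈ₛ-sym (X^-+ 1 j)))) ⟩
    const a ⊛ (const (β * pow q e) ⊛ (X^ (suc j) ⊛ D))
      ≈⟨ ≈ₛ-trans (const⊛≈• a _) (•-cong refl (const⊛≈• (β * pow q e) (X^ (suc j) ⊛ D))) ⟩
    a • ((β * pow q e) • (X^ (suc j) ⊛ D)) ∎
    where
    open SeriesReasoning
    β : Carrier
    β = B (suc j) 1

  correctionTerm : ∀ n → ((a • X) ⊛ T.C (suc n)) ≈ₛ
    (a • sumS (suc n) (λ k → (B (suc n ∸ k) 1 * pow q ((suc n ∸ k) *ℕ k)) • (X^ (suc n ∸ k) ⊛ quot q b k a (suc k))))
  correctionTerm n = begin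
    (a • X) ⊛ W.sumR (suc n) t                    ≈⟨ WF.sumR-*ˡ (suc n) (a • X) t ⟩
    W.sumR (suc n) (λ k → (a • X) ⊛ t k)          ≈⟨ WF.sumR-cong (suc n) termwise ⟩
    W.sumR (suc n) (λ k → a • u k)                ≈⟨ sumR-series (suc n) (λ k → a • u k) ⟩
    sumS (suc n) (λ k → a • u k)                  ≈⟨ (λ m → sumR-*ˡ (suc n) a (λ k → u k m)) ⟨
    a • sumS (suc n) u                            ∎
    where
    open SeriesReasoning
    t u : ℕ → Series
    t k = (B′ (suc n ∸ k) 1 ⊛ W.pow (const q) ((suc n ∸ k) *ℕ k)) ⊛ d′ (suc k)
    u k = (B (suc n ∸ k) 1 * pow q ((suc n ∸ k) *ℕ k)) • (X^ (suc n ∸ k) ⊛ quot q b k a (suc k))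
    termwise : ∀ k → k < suc n → ((a • X) ⊛ t k) ≈ₛ (a • u k)
    termwise k k<n+1 rewrite ℕₚ.+-∸-assoc 1 (ℕₚ.≤-pred k<n+1) =
      weightedTerm (n ∸ k) (suc (n ∸ k) *ℕ k) (d′ (suc k))

-- Σ_k B_{n+1,k} w^{n+1-k} is the coefficient L′_{n+1} of the main computation
-- over R[[w]], which equals d′_{n+1} - a w C′_{n+1}; the last term is the
-- correction sum of the corollary.
corollary2p1 : {c ℓ : Level} (R : CommutativeRing c ℓ) →
  let open CommutativeRing R
      open PS R
  in (q a b : Carrier) → ¬ (q ≈ 0#) →
     (B : ℕ → ℕ → Carrier) → IsBExpansion q a b B →
     (n : ℕ) → corLHS B (suc n) ≈ₛ corRHS q a b B (suc n)
corollary2p1 R q a b _ B hyp n = begin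
  corLHS B (suc n)                          ≈⟨ sumR-series (suc (suc n)) (B′ (suc n)) ⟨
  G′.L (suc n)                              ≈⟨ ⊕≈⇒≈⊖ (T.coefficients (suc n)) ⟩
  d′ (suc n) ⊖ ((a • X) ⊛ T.C (suc n))      ≈⟨ ⊕-cong (≈ₛ-refl {d′ (suc n)}) (⊝-cong (correctionTerm n)) ⟩
  corRHS q a b B (suc n)                    ∎
  where
  open PS R
  open PowerSeriesRing R
  open SeriesReasoning
  open SeriesToolkit R using (X)
  open Corollary R q a b B hyp
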